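{- Let $\mathcal{S}=(s_n)_{n=0}^\infty$ be a sequence over $\{0,1\}$ that is not eventually periodic, and let $h(Y)=h_0+h_1Y+\ldots+h_dY^d\in\mathbb{Z}[Y]$ be a polynomial of degree $d$ without rational roots such that $h(G_{\mathcal{S}}(2))=0$, where $G_{\mathcal{S}}(2)=\sum_{n=0}^\infty s_n2^n\in\mathbb{Z}_2$. Put $H=\sum_{i=0}^d|h_i|$. Then for all $N\geq 1$, $$\frac{N}{d}-\frac{\log_2(H)}{d}\leq \lambda_{\mathcal{S}}(N)\leq \frac{d-1}{d}N+\frac{\log_2(H)}{d}+1.3.$$
   Context: $\mathbb{Z}_2$ denotes the ring of $2$-adic integers $\sum_{n\ge 0}a_n2^n$, $a_n\in\{0,1\}$, with convergence in the $2$-adic absolute value. For a binary sequence $\mathcal{S}=(s_n)_{n=0}^\infty$ and $N\ge1$, define $$\Lambda_{\mathcal{S}}(N)=\min\left\{\max\{|f|,q\}: f,q\in\mathbb{Z},\ q>0 \text{ odd},\ q\sum_{i=0}^{N-1}s_i2^i\equiv f \bmod 2^N\right\},$$ and the $N$th $2$-adic complexity $\lambda_{\mathcal{S}}(N)=\log_2\Lambda_{\mathcal{S}}(N)$. A sequence is eventually periodic if there exist $T\ge1$ and $n_0$ with $s_{n+T}=s_n$ for all $n\ge n_0$. -}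

module Defs where

open import Data.Bool using (Bool; true; false)
open import Data.Nat as ℕ using (ℕ; zero; suc; _∸_; _⊔_; _%_)
open import Data.Integer as ℤ using (ℤ; +_; ∣_∣)
open import Data.Integer.Divisibility using (_∣_)
open import Data.Rational as ℚ using (ℚ; 0ℚ)
open import Data.Fin using (Fin; toℕ; fromℕ)
open import Data.Vec using (Vec; lookup)
open import Data.Product using (Σ; ∃; _×_; _,_)
open import Relation.Binary.PropositionalEquality using (_≡_; _≢_)
open import Relation.Nullary using (¬_)

BinSeq : Set
BinSeq = ℕ → Bool

bit : Bool → ℕ
bit false = 0
bit true  = 1

EventuallyPeriodic : BinSeq → Set
EventuallyPeriodic s =
  Σ ℕ λ T → Σ ℕ λ n₀ → (1 ℕ.≤ T) × (∀ n → n₀ ℕ.≤ n → s (n ℕ.+ T) ≡ s n)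

partialSum : BinSeq → ℕ → ℕ
partialSum s zero    = 0
partialSum s (suc N) = partialSum s N ℕ.+ bit (s N) ℕ.* 2 ℕ.^ N

powℤ : ℤ → ℕ → ℤ
powℤ x zero    = + 1
powℤ x (suc n) = x ℤ.* powℤ x n

powℚ : ℚ → ℕ → ℚ
powℚ x zero    = ℚ.1ℚ
powℚ x (suc n) = x ℚ.* powℚ x n

sumℤ : (k : ℕ) → (Fin k → ℤ) → ℤ
sumℤ zero    f = + 0
sumℤ (suc k) f = f Data.Fin.zero ℤ.+ sumℤ k (λ i → f (Data.Fin.suc i))

sumℚ : (k : ℕ) → (Fin k → ℚ) → ℚ
sumℚ zero    f = 0ℚ
sumℚ (suc k) f = f Data.Fin.zero ℚ.+ sumℚ k (λ i → f (Data.Fin.suc i))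

sumℕ : (k : ℕ) → (Fin k → ℕ) → ℕ
sumℕ zero    f = 0
sumℕ (suc k) f = f Data.Fin.zero ℕ.+ sumℕ k (λ i → f (Data.Fin.suc i))

evalℤ : ∀ {d} → Vec ℤ (suc d) → ℤ → ℤ
evalℤ {d} h x = sumℤ (suc d) (λ i → lookup h i ℤ.* powℤ x (toℕ i))

evalℚ : ∀ {d} → Vec ℤ (suc d) → ℚ → ℚ
evalℚ {d} h x = sumℚ (suc d) (λ i → (lookup h i ℚ./ 1) ℚ.* powℚ x (toℕ i))

HasDegree : ∀ {d} → Vec ℤ (suc d) → Set
HasDegree {d} h = lookup h (fromℕ d) ≢ + 0

NoRationalRoots : ∀ {d} → Vec ℤ (suc d) → Set
NoRationalRoots h = ∀ (r : ℚ) → evalℚ h r ≢ 0ℚ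

height : ∀ {d} → Vec ℤ (suc d) → ℕ
height {d} h = sumℕ (suc d) (λ i → ∣ lookup h i ∣)

-- h(G_S(2)) = 0 in ℤ₂: for every N, h(G_S(2) mod 2^N) ≡ 0 mod 2^N
-- (ℤ₂ is the inverse limit of ℤ/2^N; G_S(2) mod 2^N is the partial sum)
IsTwoAdicRoot : ∀ {d} → Vec ℤ (suc d) → BinSeq → Set
IsTwoAdicRoot h s = ∀ N → (+ (2 ℕ.^ N)) ∣ evalℤ h (+ partialSum s N)

Admissible : BinSeq → ℕ → ℤ → ℕ → Set
Admissible s N f q =
  (q % 2 ≡ 1) × ((+ (2 ℕ.^ N)) ∣ ((+ q) ℤ.* (+ partialSum s N) ℤ.- f))

IsNthLambda : BinSeq → ℕ → ℕ → Set
IsNthLambda s N L =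
  (Σ ℤ λ f → Σ ℕ λ q → Admissible s N f q × (∣ f ∣ ⊔ q ≡ L))
  × (∀ f q → Admissible s N f q → L ℕ.≤ ∣ f ∣ ⊔ q)

{-# OPTIONS --safe #-}
module Submission where

-- Write M = 2^N and x = Σ_{i<N} s_i 2^i. The pairs (c , e) ∈ ℤ² with e x ≡ c (mod M) form a
-- lattice 𝓛 of determinant M, and Λ_S(N) is the least sup-norm of a vector of 𝓛 whose second
-- coordinate is odd. For a nonzero v = (c , e) ∈ 𝓛 the homogenised value
-- F(c , e) = Σ h_i c^i e^(d-i) = e^d h(c/e) is a nonzero integer (h has no rational roots and
-- h_d ≠ 0) which is divisible by M, because e^d h(x) ≡ F(c , e) and h(x) ≡ 0 (mod M).
-- Since |F(c , e)| ≤ H ‖v‖^d, every nonzero lattice vector satisfies M ≤ H ‖v‖^d; for the odd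
-- minimum this is the lower bound. For the upper bound, Lagrange-Gauss reduction against the
-- odd minimum yields a nonzero v ∈ 𝓛 with ‖v‖ Λ ≤ 2M, whence M Λ^d ≤ H (‖v‖ Λ)^d ≤ H (2M)^d,
-- that is Λ^d ≤ 2^d H M^(d-1); the stated bound with the constant 1.3 is weaker.

open import Defs
open import Data.Nat using (ℕ)
open import Data.Integer using (ℤ; +_; -[1+_]; ∣_∣; 0ℤ; 1ℤ)
open import Data.Product using (∃; ∃₂; _×_; _,_; proj₁; proj₂; swap)
open import Data.Sum using (inj₁; inj₂)
open import Function using (_∘_)
open import Relation.Binary.PropositionalEquality
open import Relation.Nullary using (¬_; yes; no)
open import Relation.Nullary.Negation using (contradiction)

module Integers where

  open import Data.Integer using (_+_; _*_; _-_; -_; -1ℤ)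
  import Data.Integer.Properties as ℤ
  open import Data.Integer.Divisibility.Signed using (_∣_; divides; ∣m∣n⇒∣m+n; ∣n⇒∣m*n)
  open import Data.Integer.Tactic.RingSolver using (solve-∀)
  open import Data.Nat as ℕ using (_<_)
  import Data.Nat.Properties as ℕ
  open import Data.Nat.GCD using (module Bézout)
  open import Data.Nat.Coprimality using (Coprime; coprime-Bézout)

  0<∣i∣⇒i≢0 : ∀ {i} → 0 < ∣ i ∣ → i ≢ 0ℤ
  0<∣i∣⇒i≢0 0<∣i∣ refl = ℕ.<-irrefl refl 0<∣i∣

  sgn : ℤ → ℤ
  sgn (+ _)    = 1ℤ
  sgn -[1+ _ ] = -1ℤ

  sgn*i≡∣i∣ : ∀ i → sgn i * i ≡ + ∣ i ∣
  sgn*i≡∣i∣ (+ n)    = ℤ.*-identityˡ (+ n)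
  sgn*i≡∣i∣ -[1+ n ] = ℤ.-1*i≡-i -[1+ n ]

  bézout⁺ : ∀ i j a b → 1 ℕ.+ b ℕ.* ∣ j ∣ ≡ a ℕ.* ∣ i ∣ → ∃₂ λ α β → α * i + β * j ≡ 1ℤ
  bézout⁺ i j a b eq = + a * sgn i , - (+ b * sgn j) , (begin
    + a * sgn i * i + - (+ b * sgn j) * j   ≡⟨ rearrange (+ a) (+ b) (sgn i) (sgn j) i j ⟩
    + a * (sgn i * i) - + b * (sgn j * j)   ≡⟨ cong₂ (λ I J → + a * I - + b * J) (sgn*i≡∣i∣ i) (sgn*i≡∣i∣ j) ⟩
    + a * + ∣ i ∣ - + b * + ∣ j ∣           ≡⟨ cong (_- + b * + ∣ j ∣) eqℤ ⟨
    1ℤ + + b * + ∣ j ∣ - + b * + ∣ j ∣     ≡⟨ cancel (+ b * + ∣ j ∣) ⟩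
    1ℤ                                    ∎)
    where
    open ≡-Reasoning
    rearrange : ∀ a b σ τ i j → a * σ * i + - (b * τ) * j ≡ a * (σ * i) - b * (τ * j)
    rearrange = solve-∀
    cancel : ∀ X → 1ℤ + X - X ≡ 1ℤ
    cancel = solve-∀
    eqℤ : 1ℤ + + b * + ∣ j ∣ ≡ + a * + ∣ i ∣
    eqℤ = begin
      1ℤ + + b * + ∣ j ∣      ≡⟨ cong (_+_ 1ℤ) (ℤ.pos-* b ∣ j ∣) ⟨
      + (1 ℕ.+ b ℕ.* ∣ j ∣)   ≡⟨ cong +_ eq ⟩
      + (a ℕ.* ∣ i ∣)         ≡⟨ ℤ.pos-* a ∣ i ∣ ⟩
      + a * + ∣ i ∣           ∎

  bézout : ∀ i j → Coprime ∣ i ∣ ∣ j ∣ → ∃₂ λ α β → α * i + β * j ≡ 1ℤ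
  bézout i j coprime with coprime-Bézout coprime
  ... | Bézout.+- a b eq = bézout⁺ i j a b eq
  ... | Bézout.-+ a b eq with bézout⁺ j i b a eq
  ...   | α , β , αj+βi≡1 = β , α , trans (ℤ.+-comm (β * i) (α * j)) αj+βi≡1

  Odd : ℤ → Set
  Odd e = ¬ (+ 2 ∣ e)

  odd⇒≢0 : ∀ {e} → Odd e → e ≢ 0ℤ
  odd⇒≢0 odd refl = odd (divides 0ℤ refl)

  odd-⊟ : ∀ {a b} t → Odd a → ¬ Odd b → Odd (a - t * b)
  odd-⊟ {a} {b} t odd-a not-odd-b 2∣a-tb =
    not-odd-b λ 2∣b → odd-a (subst (+ 2 ∣_) (lemma a b t) (∣m∣n⇒∣m+n 2∣a-tb (∣n⇒∣m*n t 2∣b)))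
    where
    lemma : ∀ a b t → a - t * b + t * b ≡ a
    lemma = solve-∀

module Plane where

  open import Data.Integer using (_+_; _*_; _-_; -_; _⊖_; ≢-nonZero)
  open import Data.Integer.DivMod using (_/_; _%_; a≡a%n+[a/n]*n; n%d<d)
  import Data.Integer.Properties as ℤ
  open import Data.Integer.Tactic.RingSolver using (solve-∀)
  import Data.Nat.Tactic.RingSolver as ℕSolver
  open import Data.Nat as ℕ using (ℕ; _⊔_; _≤_; _<_; _∸_)
  import Data.Nat.Properties as ℕ
  open Integers using (sgn; sgn*i≡∣i∣; 0<∣i∣⇒i≢0)

  ℤ² : Set
  ℤ² = ℤ × ℤ

  infixr 7 _⊙_
  infixl 6 _⊟_

  _⊙_ : ℤ → ℤ² → ℤ²
  t ⊙ (c , e) = t * c , t * e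

  _⊟_ : ℤ² → ℤ² → ℤ²
  (a , b) ⊟ (c , e) = a - c , b - e

  ‖_‖ : ℤ² → ℕ
  ‖ c , e ‖ = ∣ c ∣ ⊔ ∣ e ∣

  det : ℤ² → ℤ² → ℤ
  det (a , b) (c , e) = a * e - b * c

  det-⊟⊙ : ∀ u w t → det u (w ⊟ t ⊙ u) ≡ det u w
  det-⊟⊙ (a , b) (c , e) t = lemma a b c e t
    where
    lemma : ∀ a b c e t → a * (e - t * b) - b * (c - t * a) ≡ a * e - b * c
    lemma = solve-∀

  ∣det∣-comm : ∀ u w → ∣ det w u ∣ ≡ ∣ det u w ∣
  ∣det∣-comm (a , b) (c , e) = trans (cong ∣_∣ (lemma a b c e)) (ℤ.∣-i∣≡∣i∣ (a * e - b * c))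
    where
    lemma : ∀ a b c e → c * b - e * a ≡ - (a * e - b * c)
    lemma = solve-∀

  ∣det∣-swap : ∀ u w → ∣ det (swap u) (swap w) ∣ ≡ ∣ det u w ∣
  ∣det∣-swap (a , b) (c , e) = trans (cong ∣_∣ (lemma a b c e)) (ℤ.∣-i∣≡∣i∣ (a * e - b * c))
    where
    lemma : ∀ a b c e → b * c - a * e ≡ - (a * e - b * c)
    lemma = solve-∀

  ‖swap‖ : ∀ v → ‖ swap v ‖ ≡ ‖ v ‖
  ‖swap‖ (c , e) = ℕ.⊔-comm ∣ e ∣ ∣ c ∣

  ‖‖≡0⇒≡0 : ∀ v → ‖ v ‖ ≡ 0 → v ≡ (0ℤ , 0ℤ)
  ‖‖≡0⇒≡0 (c , e) ‖v‖≡0 = cong₂ _,_ (vanishes (ℕ.m≤m⊔n ∣ c ∣ ∣ e ∣)) (vanishes (ℕ.m≤n⊔m ∣ c ∣ ∣ e ∣))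
    where
    vanishes : ∀ {z} → ∣ z ∣ ≤ ‖ c , e ‖ → z ≡ 0ℤ
    vanishes z≤‖v‖ = ℤ.∣i∣≡0⇒i≡0 (ℕ.n≤0⇒n≡0 (subst (_ ≤_) ‖v‖≡0 z≤‖v‖))

  det≢0⇒‖‖>0 : ∀ u w → det u w ≢ 0ℤ → 0 < ‖ w ‖
  det≢0⇒‖‖>0 u@(a , b) w det≢0 = ℕ.n≢0⇒n>0 λ ‖w‖≡0 →
    det≢0 (subst (λ w → det u w ≡ 0ℤ) (sym (‖‖≡0⇒≡0 w ‖w‖≡0)) (lemma a b))
    where
    lemma : ∀ a b → a * 0ℤ - b * 0ℤ ≡ 0ℤ
    lemma = solve-∀

  e≢0⇒0<‖c,e‖ : ∀ c {e} → e ≢ 0ℤ → 0 < ‖ c , e ‖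
  e≢0⇒0<‖c,e‖ c {e} e≢0 = ℕ.<-≤-trans (ℕ.n≢0⇒n>0 (e≢0 ∘ ℤ.∣i∣≡0⇒i≡0)) (ℕ.m≤n⊔m ∣ c ∣ ∣ e ∣)

  round-remainder : ∀ a b r Q → r < ∣ b ∣ → a ≡ + r + Q * b → ∃ λ t → 2 ℕ.* ∣ a - t * b ∣ ≤ ∣ b ∣
  round-remainder _ b r Q r<∣b∣ refl with 2 ℕ.* r ℕ.≤? ∣ b ∣
  ... | yes 2r≤∣b∣ = Q , subst (λ z → 2 ℕ.* ∣ z ∣ ≤ ∣ b ∣) (sym (lemma (+ r) Q b)) 2r≤∣b∣
    where
    lemma : ∀ r Q b → r + Q * b - Q * b ≡ r
    lemma = solve-∀
  ... | no 2r≰∣b∣ = Q + sgn b , subst (λ z → 2 ℕ.* ∣ z ∣ ≤ ∣ b ∣) (sym overshoot) bound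
    where
    lemma : ∀ r Q σ b → r + Q * b - (Q + σ) * b ≡ r - σ * b
    lemma = solve-∀
    overshoot : + r + Q * b - (Q + sgn b) * b ≡ r ⊖ ∣ b ∣
    overshoot = trans (lemma (+ r) Q (sgn b) b)
      (trans (cong (λ z → + r - z) (sgn*i≡∣i∣ b)) (ℤ.m-n≡m⊖n r ∣ b ∣))
    2∣b∣≤2r+∣b∣ : 2 ℕ.* ∣ b ∣ ≤ 2 ℕ.* r ℕ.+ ∣ b ∣
    2∣b∣≤2r+∣b∣ = subst (_≤ 2 ℕ.* r ℕ.+ ∣ b ∣) (cong (∣ b ∣ ℕ.+_) (sym (ℕ.+-identityʳ ∣ b ∣)))
      (ℕ.+-monoˡ-≤ ∣ b ∣ (ℕ.<⇒≤ (ℕ.≰⇒> 2r≰∣b∣)))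
    bound : 2 ℕ.* ∣ r ⊖ ∣ b ∣ ∣ ≤ ∣ b ∣
    bound = begin
      2 ℕ.* ∣ r ⊖ ∣ b ∣ ∣     ≡⟨ cong (2 ℕ.*_) (ℤ.∣⊖∣-≤ (ℕ.<⇒≤ r<∣b∣)) ⟩
      2 ℕ.* (∣ b ∣ ∸ r)       ≡⟨ ℕ.*-distribˡ-∸ 2 ∣ b ∣ r ⟩
      2 ℕ.* ∣ b ∣ ∸ 2 ℕ.* r   ≤⟨ ℕ.m≤n+o⇒m∸n≤o (2 ℕ.* ∣ b ∣) (2 ℕ.* r) 2∣b∣≤2r+∣b∣ ⟩
      ∣ b ∣                   ∎
      where open ℕ.≤-Reasoning

  round : ∀ a b → b ≢ 0ℤ → ∃ λ t → 2 ℕ.* ∣ a - t * b ∣ ≤ ∣ b ∣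
  round a b b≢0 = round-remainder a b (a % b) (a / b) (n%d<d a b) (a≡a%n+[a/n]*n a b)
    where instance _ = ≢-nonZero b≢0

  dominant-bound : ∀ {A B X Y D} → A ≤ B → 2 ℕ.* Y ≤ B → B ℕ.* X ≤ A ℕ.* Y ℕ.+ D →
    2 ℕ.* B ℕ.* (X ⊔ Y) ≤ 2 ℕ.* D ℕ.+ B ℕ.* B
  dominant-bound {A} {B} {X} {Y} {D} A≤B 2Y≤B BX≤AY+D =
    ℕ.≤-trans (ℕ.≤-reflexive (ℕ.*-distribˡ-⊔ (2 ℕ.* B) X Y)) (ℕ.⊔-lub 2BX≤ 2BY≤)
    where
    open ℕ.≤-Reasoning
    rearrange : ∀ A Y D → 2 ℕ.* (A ℕ.* Y ℕ.+ D) ≡ A ℕ.* (2 ℕ.* Y) ℕ.+ 2 ℕ.* D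
    rearrange = ℕSolver.solve-∀
    2BX≤ : 2 ℕ.* B ℕ.* X ≤ 2 ℕ.* D ℕ.+ B ℕ.* B
    2BX≤ = begin
      2 ℕ.* B ℕ.* X               ≡⟨ ℕ.*-assoc 2 B X ⟩
      2 ℕ.* (B ℕ.* X)             ≤⟨ ℕ.*-monoʳ-≤ 2 BX≤AY+D ⟩
      2 ℕ.* (A ℕ.* Y ℕ.+ D)       ≡⟨ rearrange A Y D ⟩
      A ℕ.* (2 ℕ.* Y) ℕ.+ 2 ℕ.* D ≤⟨ ℕ.+-monoˡ-≤ (2 ℕ.* D) (ℕ.*-mono-≤ A≤B 2Y≤B) ⟩
      B ℕ.* B ℕ.+ 2 ℕ.* D         ≡⟨ ℕ.+-comm (B ℕ.* B) (2 ℕ.* D) ⟩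
      2 ℕ.* D ℕ.+ B ℕ.* B         ∎
    2BY≤ : 2 ℕ.* B ℕ.* Y ≤ 2 ℕ.* D ℕ.+ B ℕ.* B
    2BY≤ = begin
      2 ℕ.* B ℕ.* Y       ≡⟨ ℕ.*-assoc 2 B Y ⟩
      2 ℕ.* (B ℕ.* Y)     ≡⟨ cong (2 ℕ.*_) (ℕ.*-comm B Y) ⟩
      2 ℕ.* (Y ℕ.* B)     ≡⟨ ℕ.*-assoc 2 Y B ⟨
      2 ℕ.* Y ℕ.* B       ≤⟨ ℕ.*-monoˡ-≤ B 2Y≤B ⟩
      B ℕ.* B             ≤⟨ ℕ.m≤n+m (B ℕ.* B) (2 ℕ.* D) ⟩
      2 ℕ.* D ℕ.+ B ℕ.* B ∎

  Reduction : ℤ² → ℤ² → Set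
  Reduction u w = ∃ λ t → 2 ℕ.* ‖ u ‖ ℕ.* ‖ w ⊟ t ⊙ u ‖ ≤ 2 ℕ.* ∣ det u w ∣ ℕ.+ ‖ u ‖ ℕ.* ‖ u ‖

  reduce-dominant : ∀ u w → ∣ proj₁ u ∣ ≤ ∣ proj₂ u ∣ → 0 < ‖ u ‖ → Reduction u w
  reduce-dominant (a , b) (c , e) A≤B 0<‖u‖ with round e b (0<∣i∣⇒i≢0 (subst (0 <_) ‖u‖≡B 0<‖u‖))
    where ‖u‖≡B = ℕ.m≤n⇒m⊔n≡n A≤B
  ... | t , 2Y≤B = t , subst (λ ℓ → 2 ℕ.* ℓ ℕ.* (X ⊔ Y) ≤ 2 ℕ.* D ℕ.+ ℓ ℕ.* ℓ) (sym (ℕ.m≤n⇒m⊔n≡n A≤B))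
                         (dominant-bound {∣ a ∣} {∣ b ∣} {X} {Y} {D} A≤B 2Y≤B BX≤AY+D)
    where
    open ℕ.≤-Reasoning
    X = ∣ c - t * a ∣
    Y = ∣ e - t * b ∣
    D = ∣ a * e - b * c ∣
    identity : ∀ a b c e t → b * (c - t * a) ≡ a * (e - t * b) - (a * e - b * c)
    identity = solve-∀
    BX≤AY+D : ∣ b ∣ ℕ.* X ≤ ∣ a ∣ ℕ.* Y ℕ.+ D
    BX≤AY+D = begin
      ∣ b ∣ ℕ.* X                              ≡⟨ ℤ.abs-* b (c - t * a) ⟨
      ∣ b * (c - t * a) ∣                       ≡⟨ cong ∣_∣ (identity a b c e t) ⟩
      ∣ a * (e - t * b) - (a * e - b * c) ∣     ≤⟨ ℤ.∣i-j∣≤∣i∣+∣j∣ (a * (e - t * b)) (a * e - b * c) ⟩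
      ∣ a * (e - t * b) ∣ ℕ.+ D                 ≡⟨ cong (ℕ._+ D) (ℤ.abs-* a (e - t * b)) ⟩
      ∣ a ∣ ℕ.* Y ℕ.+ D                        ∎

  reduction-swap : ∀ u w → Reduction (swap u) (swap w) → Reduction u w
  reduction-swap u w (t , bound) =
    t , subst₂ (λ ℓ D → 2 ℕ.* ℓ ℕ.* ‖ w ⊟ t ⊙ u ‖ ≤ 2 ℕ.* D ℕ.+ ℓ ℕ.* ℓ) (‖swap‖ u) (∣det∣-swap u w)
          (subst (λ n → 2 ℕ.* ‖ swap u ‖ ℕ.* n ≤ 2 ℕ.* ∣ det (swap u) (swap w) ∣ ℕ.+ ‖ swap u ‖ ℕ.* ‖ swap u ‖)
            (‖swap‖ (w ⊟ t ⊙ u)) bound)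

  -- One step of Lagrange-Gauss reduction: w is rounded along the larger coordinate of u.
  reduce : ∀ u w → 0 < ‖ u ‖ → Reduction u w
  reduce u w 0<‖u‖ with ℕ.≤-total ∣ proj₁ u ∣ ∣ proj₂ u ∣
  ... | inj₁ A≤B = reduce-dominant u w A≤B 0<‖u‖
  ... | inj₂ B≤A =
    reduction-swap u w (reduce-dominant (swap u) (swap w) B≤A (subst (0 <_) (sym (‖swap‖ u)) 0<‖u‖))

  shorter-than : ∀ {L a m} → 2 ℕ.* L ℕ.* a ≤ 2 ℕ.* m ℕ.+ L ℕ.* L → 2 ℕ.* m < L ℕ.* L → a < L
  shorter-than {L} {a} {m} 2La≤2m+L² 2m<L² = ℕ.*-cancelˡ-< (2 ℕ.* L) a L (begin-strict
    2 ℕ.* L ℕ.* a           ≤⟨ 2La≤2m+L² ⟩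
    2 ℕ.* m ℕ.+ L ℕ.* L     <⟨ ℕ.+-monoˡ-< (L ℕ.* L) 2m<L² ⟩
    L ℕ.* L ℕ.+ L ℕ.* L     ≡⟨ rearrange L ⟩
    2 ℕ.* L ℕ.* L           ∎)
    where
    open ℕ.≤-Reasoning
    rearrange : ∀ L → L ℕ.* L ℕ.+ L ℕ.* L ≡ 2 ℕ.* L ℕ.* L
    rearrange = ℕSolver.solve-∀

  product-bound : ∀ {a L m} → a ≤ L → 2 ℕ.* a ℕ.* L ≤ 2 ℕ.* m ℕ.+ a ℕ.* a → a ℕ.* L ≤ 2 ℕ.* m
  product-bound {a} {L} {m} a≤L 2aL≤2m+a² = ℕ.+-cancelʳ-≤ (a ℕ.* L) (a ℕ.* L) (2 ℕ.* m) (begin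
    a ℕ.* L ℕ.+ a ℕ.* L     ≡⟨ rearrange a L ⟩
    2 ℕ.* a ℕ.* L           ≤⟨ 2aL≤2m+a² ⟩
    2 ℕ.* m ℕ.+ a ℕ.* a     ≤⟨ ℕ.+-monoʳ-≤ (2 ℕ.* m) (ℕ.*-monoʳ-≤ a a≤L) ⟩
    2 ℕ.* m ℕ.+ a ℕ.* L     ∎)
    where
    open ℕ.≤-Reasoning
    rearrange : ∀ a L → a ℕ.* L ℕ.+ a ℕ.* L ≡ 2 ℕ.* a ℕ.* L
    rearrange = ℕSolver.solve-∀

module Homogenization where

  open import Data.Integer using (_+_; _*_; _-_; -_)
  import Data.Integer.Properties as ℤ
  open import Data.Integer.Divisibility.Signed using (_∣_; divides; ∣m∣n⇒∣m+n; ∣n⇒∣m*n)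
  open import Data.Integer.Tactic.RingSolver using (solve-∀)
  open import Data.Nat as ℕ using (ℕ; zero; suc; _∸_; _≤_; _<_)
  import Data.Nat.Properties as ℕ
  open import Data.Rational as ℚ using (ℚ; 0ℚ; 1ℚ; toℚᵘ)
  import Data.Rational.Properties as ℚ
  open import Data.Rational.Unnormalised as ℚᵘ using (mkℚᵘ; *≡*) renaming (_≃_ to _≃ᵘ_)
  import Data.Rational.Unnormalised.Properties as ℚᵘ
  open import Data.Fin as Fin using (Fin; toℕ; fromℕ)
  open import Data.Fin.Properties using (toℕ≤pred[n]; toℕ-fromℕ)
  open import Data.Vec using (Vec; lookup)
  open import Algebra.Bundles using (CommutativeMonoid)
  open Plane using (ℤ²; ‖_‖)

  fromℤ : ℤ → ℚ
  fromℤ z = z ℚ./ 1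

  -- ℚ normalises its results, so the homomorphism laws are checked in ℚᵘ.
  toℚᵘ-fromℤ : ∀ z → toℚᵘ (fromℤ z) ≃ᵘ mkℚᵘ z 0
  toℚᵘ-fromℤ z = ℚ.toℚᵘ-fromℚᵘ (mkℚᵘ z 0)

  fromℤ-+ : ∀ a b → fromℤ (a + b) ≡ fromℤ a ℚ.+ fromℤ b
  fromℤ-+ a b = ℚ.toℚᵘ-injective (begin
    toℚᵘ (fromℤ (a + b))            ≈⟨ toℚᵘ-fromℤ (a + b) ⟩
    mkℚᵘ (a + b) 0                  ≈⟨ *≡* (lemma a b) ⟩
    mkℚᵘ a 0 ℚᵘ.+ mkℚᵘ b 0          ≈⟨ ℚᵘ.+-cong (toℚᵘ-fromℤ a) (toℚᵘ-fromℤ b) ⟨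
    toℚᵘ (fromℤ a) ℚᵘ.+ toℚᵘ (fromℤ b) ≈⟨ ℚ.toℚᵘ-homo-+ (fromℤ a) (fromℤ b) ⟨
    toℚᵘ (fromℤ a ℚ.+ fromℤ b)      ∎)
    where
    open ℚᵘ.≃-Reasoning
    lemma : ∀ a b → (a + b) * 1ℤ ≡ (a * 1ℤ + b * 1ℤ) * 1ℤ
    lemma = solve-∀

  fromℤ-* : ∀ a b → fromℤ (a * b) ≡ fromℤ a ℚ.* fromℤ b
  fromℤ-* a b = ℚ.toℚᵘ-injective (begin
    toℚᵘ (fromℤ (a * b))            ≈⟨ toℚᵘ-fromℤ (a * b) ⟩
    mkℚᵘ (a * b) 0                  ≈⟨ ℚᵘ.≃-refl ⟩
    mkℚᵘ a 0 ℚᵘ.* mkℚᵘ b 0          ≈⟨ ℚᵘ.*-cong (toℚᵘ-fromℤ a) (toℚᵘ-fromℤ b) ⟨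
    toℚᵘ (fromℤ a) ℚᵘ.* toℚᵘ (fromℤ b) ≈⟨ ℚ.toℚᵘ-homo-* (fromℤ a) (fromℤ b) ⟨
    toℚᵘ (fromℤ a ℚ.* fromℤ b)      ∎)
    where open ℚᵘ.≃-Reasoning

  fromℤ≡0⇒≡0 : ∀ z → fromℤ z ≡ 0ℚ → z ≡ 0ℤ
  fromℤ≡0⇒≡0 z eq with ℚᵘ.≃-trans (ℚᵘ.≃-sym (toℚᵘ-fromℤ z)) (ℚᵘ.≃-reflexive (cong toℚᵘ eq))
  ... | *≡* z*1≡0 = trans (sym (ℤ.*-identityʳ z)) z*1≡0

  sumℤ-*ˡ : ∀ k (f : Fin k → ℤ) z → z * sumℤ k f ≡ sumℤ k (λ i → z * f i)
  sumℤ-*ˡ zero    f z = ℤ.*-zeroʳ z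
  sumℤ-*ˡ (suc k) f z = trans (ℤ.*-distribˡ-+ z (f Fin.zero) _)
    (cong (_+_ (z * f Fin.zero)) (sumℤ-*ˡ k (f ∘ Fin.suc) z))

  sumℤ-∣- : ∀ {P} k (f g : Fin k → ℤ) → (∀ i → P ∣ f i - g i) → P ∣ sumℤ k f - sumℤ k g
  sumℤ-∣- zero    f g _ = divides 0ℤ refl
  sumℤ-∣- (suc k) f g P∣f-g = subst (_ ∣_) (lemma (f Fin.zero) (g Fin.zero) _ _)
    (∣m∣n⇒∣m+n (P∣f-g Fin.zero) (sumℤ-∣- k (f ∘ Fin.suc) (g ∘ Fin.suc) (P∣f-g ∘ Fin.suc)))
    where
    lemma : ∀ a b x y → (a - b) + (x - y) ≡ (a + x) - (b + y)
    lemma = solve-∀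

  sumℤ-last : ∀ d (g : Fin (suc d) → ℤ) → sumℤ (suc d) (λ i → g i * powℤ 0ℤ (d ∸ toℕ i)) ≡ g (fromℕ d)
  sumℤ-last zero    g = trans (ℤ.+-identityʳ _) (ℤ.*-identityʳ (g Fin.zero))
  sumℤ-last (suc d) g = begin
    g Fin.zero * 0ℤ + rest ≡⟨ cong (_+ rest) (ℤ.*-zeroʳ (g Fin.zero)) ⟩
    0ℤ + rest              ≡⟨ ℤ.+-identityˡ rest ⟩
    rest                   ≡⟨ sumℤ-last d (g ∘ Fin.suc) ⟩
    g (fromℕ (suc d))      ∎
    where
    open ≡-Reasoning
    rest = sumℤ (suc d) (λ i → g (Fin.suc i) * powℤ 0ℤ (d ∸ toℕ i))

  ∣sumℤ∣≤ : ∀ k (f : Fin k → ℤ) → ∣ sumℤ k f ∣ ≤ sumℕ k (λ i → ∣ f i ∣)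
  ∣sumℤ∣≤ zero    f = ℕ.z≤n
  ∣sumℤ∣≤ (suc k) f = ℕ.≤-trans (ℤ.∣i+j∣≤∣i∣+∣j∣ (f Fin.zero) _)
    (ℕ.+-monoʳ-≤ ∣ f Fin.zero ∣ (∣sumℤ∣≤ k (f ∘ Fin.suc)))

  sumℕ-mono-≤ : ∀ k {f g : Fin k → ℕ} → (∀ i → f i ≤ g i) → sumℕ k f ≤ sumℕ k g
  sumℕ-mono-≤ zero    f≤g = ℕ.z≤n
  sumℕ-mono-≤ (suc k) f≤g = ℕ.+-mono-≤ (f≤g Fin.zero) (sumℕ-mono-≤ k (f≤g ∘ Fin.suc))

  sumℕ-*ʳ : ∀ k (f : Fin k → ℕ) z → sumℕ k (λ i → f i ℕ.* z) ≡ sumℕ k f ℕ.* z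
  sumℕ-*ʳ zero    f z = refl
  sumℕ-*ʳ (suc k) f z = trans (cong ((f Fin.zero ℕ.* z) ℕ.+_) (sumℕ-*ʳ k (f ∘ Fin.suc) z))
    (sym (ℕ.*-distribʳ-+ z (f Fin.zero) _))

  sumℚ-cong : ∀ k {f g : Fin k → ℚ} → (∀ i → f i ≡ g i) → sumℚ k f ≡ sumℚ k g
  sumℚ-cong zero    f≡g = refl
  sumℚ-cong (suc k) f≡g = cong₂ ℚ._+_ (f≡g Fin.zero) (sumℚ-cong k (f≡g ∘ Fin.suc))

  sumℚ-*ʳ : ∀ k (f : Fin k → ℚ) z → sumℚ k f ℚ.* z ≡ sumℚ k (λ i → f i ℚ.* z)
  sumℚ-*ʳ zero    f z = ℚ.*-zeroˡ z
  sumℚ-*ʳ (suc k) f z = trans (ℚ.*-distribʳ-+ z (f Fin.zero) _)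
    (cong ((f Fin.zero ℚ.* z) ℚ.+_) (sumℚ-*ʳ k (f ∘ Fin.suc) z))

  sumℚ-fromℤ : ∀ k (f : Fin k → ℤ) → sumℚ k (fromℤ ∘ f) ≡ fromℤ (sumℤ k f)
  sumℚ-fromℤ zero    f = refl
  sumℚ-fromℤ (suc k) f = trans (cong (fromℤ (f Fin.zero) ℚ.+_) (sumℚ-fromℤ k (f ∘ Fin.suc)))
    (sym (fromℤ-+ (f Fin.zero) _))

  powℤ-+ : ∀ z m n → powℤ z (m ℕ.+ n) ≡ powℤ z m * powℤ z n
  powℤ-+ z zero    n = sym (ℤ.*-identityˡ (powℤ z n))
  powℤ-+ z (suc m) n = trans (cong (z *_) (powℤ-+ z m n)) (sym (ℤ.*-assoc z (powℤ z m) (powℤ z n)))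

  ∣powℤ∣ : ∀ z n → ∣ powℤ z n ∣ ≡ ∣ z ∣ ℕ.^ n
  ∣powℤ∣ z zero    = refl
  ∣powℤ∣ z (suc n) = trans (ℤ.abs-* z (powℤ z n)) (cong (∣ z ∣ ℕ.*_) (∣powℤ∣ z n))

  powℤ≢0 : ∀ {z} n → z ≢ 0ℤ → powℤ z n ≢ 0ℤ
  powℤ≢0 zero    z≢0 ()
  powℤ≢0 (suc n) z≢0 zzⁿ≡0 with ℤ.i*j≡0⇒i≡0∨j≡0 _ zzⁿ≡0
  ... | inj₁ z≡0  = z≢0 z≡0
  ... | inj₂ zⁿ≡0 = powℤ≢0 n z≢0 zⁿ≡0

  powℤ-congruence : ∀ {P} e x c k → P ∣ e * x - c → P ∣ powℤ e k * powℤ x k - powℤ c k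
  powℤ-congruence e x c zero    _     = divides 0ℤ refl
  powℤ-congruence e x c (suc k) P∣ex-c = subst (_ ∣_) (lemma e x c (powℤ e k) (powℤ x k) (powℤ c k))
    (∣m∣n⇒∣m+n (∣n⇒∣m*n (e * x) (powℤ-congruence e x c k P∣ex-c)) (∣n⇒∣m*n (powℤ c k) P∣ex-c))
    where
    lemma : ∀ e x c E X C → e * x * (E * X - C) + C * (e * x - c) ≡ e * E * (x * X) - c * C
    lemma = solve-∀

  powℚ-+ : ∀ z m n → powℚ z (m ℕ.+ n) ≡ powℚ z m ℚ.* powℚ z n
  powℚ-+ z zero    n = sym (ℚ.*-identityˡ (powℚ z n))
  powℚ-+ z (suc m) n = trans (cong (z ℚ.*_) (powℚ-+ z m n)) (sym (ℚ.*-assoc z (powℚ z m) (powℚ z n)))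

  powℚ-* : ∀ a b n → powℚ (a ℚ.* b) n ≡ powℚ a n ℚ.* powℚ b n
  powℚ-* a b zero    = refl
  powℚ-* a b (suc n) = trans (cong (a ℚ.* b ℚ.*_) (powℚ-* a b n)) (interchange a b (powℚ a n) (powℚ b n))
    where
    open import Algebra.Properties.CommutativeSemigroup (CommutativeMonoid.commutativeSemigroup ℚ.*-1-commutativeMonoid)
      using (interchange)

  powℚ-fromℤ : ∀ z n → powℚ (fromℤ z) n ≡ fromℤ (powℤ z n)
  powℚ-fromℤ z zero    = refl
  powℚ-fromℤ z (suc n) = trans (cong (fromℤ z ℚ.*_) (powℚ-fromℤ z n)) (sym (fromℤ-* z (powℤ z n)))

  p*q≡0⇒p≡0 : ∀ p q → q ≢ 0ℚ → p ℚ.* q ≡ 0ℚ → p ≡ 0ℚ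
  p*q≡0⇒p≡0 p q q≢0 pq≡0 = begin
    p                   ≡⟨ ℚ.*-identityʳ p ⟨
    p ℚ.* 1ℚ            ≡⟨ cong (p ℚ.*_) (ℚ.*-inverseʳ q) ⟨
    p ℚ.* (q ℚ.* 1/q)   ≡⟨ ℚ.*-assoc p q 1/q ⟨
    (p ℚ.* q) ℚ.* 1/q   ≡⟨ cong (ℚ._* 1/q) pq≡0 ⟩
    0ℚ ℚ.* 1/q          ≡⟨ ℚ.*-zeroˡ 1/q ⟩
    0ℚ                  ∎
    where
    open ≡-Reasoning
    instance _ = ℚ.≢-nonZero q≢0
    1/q = ℚ.1/ q

  monomial : ∀ {d} → Vec ℤ (suc d) → ℤ² → Fin (suc d) → ℤ
  monomial {d} h (c , e) i = lookup h i * powℤ c (toℕ i) * powℤ e (d ∸ toℕ i)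

  homogenize : ∀ {d} → Vec ℤ (suc d) → ℤ² → ℤ
  homogenize {d} h v = sumℤ (suc d) (monomial h v)

  homogenize-congruence : ∀ {d} (h : Vec ℤ (suc d)) {P} x c e → P ∣ e * x - c →
    P ∣ powℤ e d * evalℤ h x - homogenize h (c , e)
  homogenize-congruence {d} h {P} x c e P∣ex-c =
    subst (λ z → P ∣ z - homogenize h (c , e)) (sym (sumℤ-*ˡ (suc d) evalTerm (powℤ e d)))
      (sumℤ-∣- (suc d) (λ i → powℤ e d * evalTerm i) (monomial h (c , e)) term)
    where
    evalTerm : Fin (suc d) → ℤ
    evalTerm i = lookup h i * powℤ x (toℕ i)
    term : ∀ i → P ∣ powℤ e d * evalTerm i - monomial h (c , e) i
    term i = subst (P ∣_) eq (∣n⇒∣m*n (a * powℤ e (d ∸ k)) (powℤ-congruence e x c k P∣ex-c))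
      where
      a = lookup h i
      k = toℕ i
      lemma : ∀ a E′ E X C → a * E′ * (E * X - C) ≡ E′ * E * (a * X) - a * C * E′
      lemma = solve-∀
      eq : a * powℤ e (d ∸ k) * (powℤ e k * powℤ x k - powℤ c k)
         ≡ powℤ e d * (a * powℤ x k) - a * powℤ c k * powℤ e (d ∸ k)
      eq = trans (lemma a (powℤ e (d ∸ k)) (powℤ e k) (powℤ x k) (powℤ c k))
        (cong (λ z → z * (a * powℤ x k) - a * powℤ c k * powℤ e (d ∸ k))
          (trans (sym (powℤ-+ e (d ∸ k) k)) (cong (powℤ e) (ℕ.m∸n+n≡m (toℕ≤pred[n] i)))))

  ∣homogenize∣≤ : ∀ {d} (h : Vec ℤ (suc d)) v → ∣ homogenize h v ∣ ≤ height h ℕ.* ‖ v ‖ ℕ.^ d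
  ∣homogenize∣≤ {d} h v@(c , e) = begin
    ∣ homogenize h v ∣                          ≤⟨ ∣sumℤ∣≤ (suc d) (monomial h v) ⟩
    sumℕ (suc d) (λ i → ∣ monomial h v i ∣)      ≤⟨ sumℕ-mono-≤ (suc d) term-bound ⟩
    sumℕ (suc d) (λ i → ∣ lookup h i ∣ ℕ.* ‖v‖ᵈ) ≡⟨ sumℕ-*ʳ (suc d) (λ i → ∣ lookup h i ∣) ‖v‖ᵈ ⟩
    height h ℕ.* ‖v‖ᵈ                           ∎
    where
    open ℕ.≤-Reasoning
    ‖v‖ᵈ = ‖ v ‖ ℕ.^ d
    term-bound : ∀ i → ∣ monomial h v i ∣ ≤ ∣ lookup h i ∣ ℕ.* ‖v‖ᵈ
    term-bound i = begin
      ∣ monomial h v i ∣                             ≡⟨ abs-monomial ⟩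
      ∣ a ∣ ℕ.* ∣ c ∣ ℕ.^ k ℕ.* ∣ e ∣ ℕ.^ (d ∸ k)      ≤⟨ ℕ.*-mono-≤ (ℕ.*-monoʳ-≤ ∣ a ∣ (ℕ.^-monoˡ-≤ k ∣c∣≤‖v‖))
                                                                    (ℕ.^-monoˡ-≤ (d ∸ k) ∣e∣≤‖v‖) ⟩
      ∣ a ∣ ℕ.* ‖ v ‖ ℕ.^ k ℕ.* ‖ v ‖ ℕ.^ (d ∸ k)      ≡⟨ ℕ.*-assoc ∣ a ∣ (‖ v ‖ ℕ.^ k) (‖ v ‖ ℕ.^ (d ∸ k)) ⟩
      ∣ a ∣ ℕ.* (‖ v ‖ ℕ.^ k ℕ.* ‖ v ‖ ℕ.^ (d ∸ k))    ≡⟨ cong (∣ a ∣ ℕ.*_) (ℕ.^-distribˡ-+-* ‖ v ‖ k (d ∸ k)) ⟨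
      ∣ a ∣ ℕ.* ‖ v ‖ ℕ.^ (k ℕ.+ (d ∸ k))            ≡⟨ cong (λ n → ∣ a ∣ ℕ.* ‖ v ‖ ℕ.^ n) (ℕ.m+[n∸m]≡n (toℕ≤pred[n] i)) ⟩
      ∣ a ∣ ℕ.* ‖v‖ᵈ                                 ∎
      where
      a = lookup h i
      k = toℕ i
      ∣c∣≤‖v‖ = ℕ.m≤m⊔n ∣ c ∣ ∣ e ∣
      ∣e∣≤‖v‖ = ℕ.m≤n⊔m ∣ c ∣ ∣ e ∣
      abs-monomial : ∣ monomial h v i ∣ ≡ ∣ a ∣ ℕ.* ∣ c ∣ ℕ.^ k ℕ.* ∣ e ∣ ℕ.^ (d ∸ k)
      abs-monomial = begin-equality
        ∣ a * powℤ c k * powℤ e (d ∸ k) ∣              ≡⟨ ℤ.abs-* (a * powℤ c k) (powℤ e (d ∸ k)) ⟩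
        ∣ a * powℤ c k ∣ ℕ.* ∣ powℤ e (d ∸ k) ∣         ≡⟨ cong₂ ℕ._*_ (ℤ.abs-* a (powℤ c k)) (∣powℤ∣ e (d ∸ k)) ⟩
        ∣ a ∣ ℕ.* ∣ powℤ c k ∣ ℕ.* ∣ e ∣ ℕ.^ (d ∸ k)     ≡⟨ cong (λ z → ∣ a ∣ ℕ.* z ℕ.* ∣ e ∣ ℕ.^ (d ∸ k)) (∣powℤ∣ c k) ⟩
        ∣ a ∣ ℕ.* ∣ c ∣ ℕ.^ k ℕ.* ∣ e ∣ ℕ.^ (d ∸ k)      ∎

  homogenize-zeroʳ : ∀ {d} (h : Vec ℤ (suc d)) c →
    homogenize h (c , 0ℤ) ≡ lookup h (fromℕ d) * powℤ c d
  homogenize-zeroʳ {d} h c = trans (sumℤ-last d (λ i → lookup h i * powℤ c (toℕ i)))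
    (cong (λ n → lookup h (fromℕ d) * powℤ c n) (toℕ-fromℕ d))

  fromℤ-homogenize : ∀ {d} (h : Vec ℤ (suc d)) c e r → r ℚ.* fromℤ e ≡ fromℤ c →
    fromℤ (homogenize h (c , e)) ≡ evalℚ h r ℚ.* powℚ (fromℤ e) d
  fromℤ-homogenize {d} h c e r re≡c = begin
    fromℤ (homogenize h (c , e))                ≡⟨ sumℚ-fromℤ (suc d) (monomial h (c , e)) ⟨
    sumℚ (suc d) (fromℤ ∘ monomial h (c , e))   ≡⟨ sumℚ-cong (suc d) term ⟩
    sumℚ (suc d) (λ i → evalTerm i ℚ.* Eᵈ)      ≡⟨ sumℚ-*ʳ (suc d) evalTerm Eᵈ ⟨
    evalℚ h r ℚ.* Eᵈ                           ∎
    where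
    open ≡-Reasoning
    E = fromℤ e
    Eᵈ = powℚ E d
    evalTerm : Fin (suc d) → ℚ
    evalTerm i = fromℤ (lookup h i) ℚ.* powℚ r (toℕ i)
    term : ∀ i → fromℤ (monomial h (c , e) i) ≡ evalTerm i ℚ.* Eᵈ
    term i = begin
      fromℤ (a * powℤ c k * powℤ e (d ∸ k))
        ≡⟨ trans (fromℤ-* (a * powℤ c k) _) (cong (ℚ._* _) (fromℤ-* a (powℤ c k))) ⟩
      A ℚ.* fromℤ (powℤ c k) ℚ.* fromℤ (powℤ e (d ∸ k))
        ≡⟨ cong₂ (λ u v → A ℚ.* u ℚ.* v) (powℚ-fromℤ c k) (powℚ-fromℤ e (d ∸ k)) ⟨
      A ℚ.* powℚ (fromℤ c) k ℚ.* powℚ E (d ∸ k)               ≡⟨ cong (λ u → A ℚ.* powℚ u k ℚ.* powℚ E (d ∸ k)) re≡c ⟨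
      A ℚ.* powℚ (r ℚ.* E) k ℚ.* powℚ E (d ∸ k)               ≡⟨ cong (λ u → A ℚ.* u ℚ.* powℚ E (d ∸ k)) (powℚ-* r E k) ⟩
      A ℚ.* (powℚ r k ℚ.* powℚ E k) ℚ.* powℚ E (d ∸ k)        ≡⟨ cong (ℚ._* powℚ E (d ∸ k)) (ℚ.*-assoc A (powℚ r k) (powℚ E k)) ⟨
      A ℚ.* powℚ r k ℚ.* powℚ E k ℚ.* powℚ E (d ∸ k)          ≡⟨ ℚ.*-assoc (A ℚ.* powℚ r k) (powℚ E k) (powℚ E (d ∸ k)) ⟩
      A ℚ.* powℚ r k ℚ.* (powℚ E k ℚ.* powℚ E (d ∸ k))        ≡⟨ cong (A ℚ.* powℚ r k ℚ.*_) (powℚ-+ E k (d ∸ k)) ⟨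
      A ℚ.* powℚ r k ℚ.* powℚ E (k ℕ.+ (d ∸ k))
        ≡⟨ cong (λ n → A ℚ.* powℚ r k ℚ.* powℚ E n) (ℕ.m+[n∸m]≡n (toℕ≤pred[n] i)) ⟩
      A ℚ.* powℚ r k ℚ.* Eᵈ                                   ∎
      where
      a = lookup h i
      A = fromℤ a
      k = toℕ i

  homogenize≢0 : ∀ {d} (h : Vec ℤ (suc d)) → HasDegree h → NoRationalRoots h →
    ∀ v → 0 < ‖ v ‖ → homogenize h v ≢ 0ℤ
  homogenize≢0 {d} h deg noRoots (c , e) ‖v‖>0 F≡0 with e ℤ.≟ 0ℤ
  ... | yes refl with ℤ.i*j≡0⇒i≡0∨j≡0 (lookup h (fromℕ d)) (trans (sym (homogenize-zeroʳ h c)) F≡0)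
  ...   | inj₁ h_d≡0 = deg h_d≡0
  ...   | inj₂ cᵈ≡0  = powℤ≢0 d (Integers.0<∣i∣⇒i≢0 (subst (0 <_) (ℕ.⊔-identityʳ ∣ c ∣) ‖v‖>0)) cᵈ≡0
  homogenize≢0 {d} h deg noRoots (c , e) ‖v‖>0 F≡0 | no e≢0 =
    noRoots r (p*q≡0⇒p≡0 (evalℚ h r) (powℚ E d) Eᵈ≢0
      (trans (sym (fromℤ-homogenize h c e r re≡c)) (cong fromℤ F≡0)))
    where
    E = fromℤ e
    E≢0 : E ≢ 0ℚ
    E≢0 = e≢0 ∘ fromℤ≡0⇒≡0 e
    instance _ = ℚ.≢-nonZero E≢0
    r = fromℤ c ℚ.÷ E
    re≡c : r ℚ.* E ≡ fromℤ c
    re≡c = trans (ℚ.*-assoc (fromℤ c) (ℚ.1/ E) E)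
      (trans (cong (fromℤ c ℚ.*_) (ℚ.*-inverseˡ E)) (ℚ.*-identityʳ (fromℤ c)))
    Eᵈ≢0 : powℚ E d ≢ 0ℚ
    Eᵈ≢0 = powℤ≢0 d e≢0 ∘ fromℤ≡0⇒≡0 (powℤ e d) ∘ trans (sym (powℚ-fromℤ e d))

module CongruenceLattice (M : ℕ) (x : ℤ) where

  open import Data.Integer using (_+_; _*_; _-_; -_)
  import Data.Integer.Properties as ℤ
  open import Data.Integer.Divisibility.Signed
    using (_∣_; divides; ∣ᵤ⇒∣; ∣⇒∣ᵤ; ∣m∣n⇒∣m-n; ∣n⇒∣m*n; ∣m⇒∣m*n)
  open import Data.Integer.Tactic.RingSolver using (solve-∀)
  open import Data.Nat as ℕ using (ℕ; suc; _≤_; _<_; _⊔_)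
  import Data.Nat.Properties as ℕ
  import Data.Nat.Divisibility as ℕ∣
  open import Data.Nat.Coprimality using (Coprime)
  open import Data.Vec using (Vec)
  open Integers using (bézout; Odd; odd⇒≢0; odd-⊟)
  open Plane
  open Homogenization using (homogenize; homogenize≢0; homogenize-congruence; ∣homogenize∣≤)

  -- (c , e) ∈ 𝓛 says that c / e approximates x modulo M; an admissible pair (f , q) of the
  -- complexity Λ is exactly a vector of 𝓛 with odd second coordinate q > 0.
  infix 4 _∈𝓛
  _∈𝓛 : ℤ² → Set
  (c , e) ∈𝓛 = + M ∣ e * x - c

  ∈𝓛-⊟⊙ : ∀ u w t → u ∈𝓛 → w ∈𝓛 → w ⊟ t ⊙ u ∈𝓛
  ∈𝓛-⊟⊙ (a , b) (c , e) t u∈𝓛 w∈𝓛 =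
    subst (+ M ∣_) (lemma a b c e t x) (∣m∣n⇒∣m-n w∈𝓛 (∣n⇒∣m*n t u∈𝓛))
    where
    lemma : ∀ a b c e t x → (e * x - c) - t * (b * x - a) ≡ (e - t * b) * x - (c - t * a)
    lemma = solve-∀

  M≤height*‖v‖^d : ∀ {d} (h : Vec ℤ (suc d)) → HasDegree h → NoRationalRoots h → + M ∣ evalℤ h x →
    ∀ v → v ∈𝓛 → 0 < ‖ v ‖ → M ≤ height h ℕ.* ‖ v ‖ ℕ.^ d
  M≤height*‖v‖^d {d} h deg noRoots M∣hx v@(c , e) v∈𝓛 0<‖v‖ =
    ℕ.≤-trans (ℕ∣.∣⇒≤ {{F≢0}} (∣⇒∣ᵤ M∣F)) (∣homogenize∣≤ h v)
    where
    F = homogenize h v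
    F≢0 : ℕ.NonZero ∣ F ∣
    F≢0 = ℕ.≢-nonZero (homogenize≢0 h deg noRoots v 0<‖v‖ ∘ ℤ.∣i∣≡0⇒i≡0)
    lemma : ∀ a F → a - (a - F) ≡ F
    lemma = solve-∀
    M∣F : + M ∣ F
    M∣F = subst (+ M ∣_) (lemma (powℤ e d * evalℤ h x) F)
      (∣m∣n⇒∣m-n (∣n⇒∣m*n (powℤ e d) M∣hx) (homogenize-congruence h x c e v∈𝓛))

  record OddMinimum (L : ℕ) : Set where
    field
      vector   : ℤ²
      vector∈𝓛 : vector ∈𝓛
      odd      : Odd (proj₂ vector)
      ‖vector‖ : ‖ vector ‖ ≡ L
      minimal  : ∀ v → v ∈𝓛 → Odd (proj₂ v) → L ≤ ‖ v ‖

  module OddMinimumProperties {L} (min : OddMinimum L) where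

    open OddMinimum min public

    f : ℤ
    f = proj₁ vector

    q : ℤ
    q = proj₂ vector

    0<‖vector‖ : 0 < ‖ vector ‖
    0<‖vector‖ = e≢0⇒0<‖c,e‖ f (odd⇒≢0 odd)

    -- A common divisor g of q and m divides the whole vector, and vector / g is again an odd
    -- vector of 𝓛, so minimality forces g = 1.
    coprime-quotient : ∀ {m} → q * x - f ≡ m * + M → Coprime ∣ q ∣ ∣ m ∣
    coprime-quotient {m} qx-f≡mM {g} (g∣q , g∣m) with ∣ᵤ⇒∣ {+ g} {q} g∣q | ∣ᵤ⇒∣ {+ g} {m} g∣m
    ... | divides a q≡ag | divides k m≡kg = ℕ.≤-antisym g≤1 (ℕ.n≢0⇒n>0 g≢0)
      where
      u′ : ℤ²
      u′ = a * x - k * + M , a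
      u′∈𝓛 : u′ ∈𝓛
      u′∈𝓛 = divides k (lemma a x k (+ M))
        where
        lemma : ∀ a x k M → a * x - (a * x - k * M) ≡ k * M
        lemma = solve-∀
      odd-a : Odd a
      odd-a 2∣a = odd (subst (+ 2 ∣_) (sym q≡ag) (∣m⇒∣m*n (+ g) 2∣a))
      f≡ : f ≡ (a * x - k * + M) * + g
      f≡ = begin
        f                             ≡⟨ lemma₁ f q x ⟩
        q * x - (q * x - f)           ≡⟨ cong₂ (λ Q R → Q * x - R) q≡ag (trans qx-f≡mM (cong (_* + M) m≡kg)) ⟩
        a * + g * x - k * + g * + M   ≡⟨ lemma₂ a (+ g) x k (+ M) ⟩
        (a * x - k * + M) * + g       ∎
        where
        open ≡-Reasoning
        lemma₁ : ∀ f q x → f ≡ q * x - (q * x - f)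
        lemma₁ = solve-∀
        lemma₂ : ∀ a g x k M → a * g * x - k * g * M ≡ (a * x - k * M) * g
        lemma₂ = solve-∀
      L≡‖u′‖*g : L ≡ ‖ u′ ‖ ℕ.* g
      L≡‖u′‖*g = begin
        L                                           ≡⟨ ‖vector‖ ⟨
        ∣ f ∣ ⊔ ∣ q ∣                                ≡⟨ cong₂ _⊔_ ∣f∣≡ ∣q∣≡ ⟩
        ∣ a * x - k * + M ∣ ℕ.* g ⊔ ∣ a ∣ ℕ.* g       ≡⟨ ℕ.*-distribʳ-⊔ g ∣ a * x - k * + M ∣ ∣ a ∣ ⟨
        ‖ u′ ‖ ℕ.* g                                ∎
        where
        open ≡-Reasoning
        ∣f∣≡ = trans (cong ∣_∣ f≡) (ℤ.abs-* (a * x - k * + M) (+ g))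
        ∣q∣≡ = trans (cong ∣_∣ q≡ag) (ℤ.abs-* a (+ g))
      g≤1 : g ≤ 1
      g≤1 = ℕ.*-cancelˡ-≤ ‖ u′ ‖ {{ℕ.>-nonZero (e≢0⇒0<‖c,e‖ (a * x - k * + M) (odd⇒≢0 odd-a))}}
        (subst₂ _≤_ L≡‖u′‖*g (sym (ℕ.*-identityʳ ‖ u′ ‖)) (minimal u′ u′∈𝓛 odd-a))
      g≢0 : g ≢ 0
      g≢0 refl = odd⇒≢0 odd (ℤ.∣i∣≡0⇒i≡0 (ℕ∣.0∣⇒≡0 g∣q))

    -- Bézout for q and the quotient m of q x - f by M completes vector to a basis of 𝓛.
    completion : ∃ λ w → w ∈𝓛 × det vector w ≡ - + M
    completion with vector∈𝓛
    ... | divides m qx-f≡mM with bézout q m (coprime-quotient {m} qx-f≡mM)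
    ...   | α , β , αq+βm≡1 = (β * x + α * + M , β) , divides (- α) (lemma₁ β x α (+ M)) , det≡-M
      where
      open ≡-Reasoning
      lemma₁ : ∀ β x α M → β * x - (β * x + α * M) ≡ - α * M
      lemma₁ = solve-∀
      lemma₂ : ∀ f q β x α M → f * β - q * (β * x + α * M) ≡ - (β * (q * x - f) + α * q * M)
      lemma₂ = solve-∀
      lemma₃ : ∀ β m α q M → β * (m * M) + α * q * M ≡ (α * q + β * m) * M
      lemma₃ = solve-∀
      det≡-M : f * β - q * (β * x + α * + M) ≡ - + M
      det≡-M = begin
        f * β - q * (β * x + α * + M)        ≡⟨ lemma₂ f q β x α (+ M) ⟩
        - (β * (q * x - f) + α * q * + M)    ≡⟨ cong (λ z → - (β * z + α * q * + M)) qx-f≡mM ⟩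
        - (β * (m * + M) + α * q * + M)      ≡⟨ cong -_ (lemma₃ β m α q (+ M)) ⟩
        - ((α * q + β * m) * + M)            ≡⟨ cong (λ z → - (z * + M)) αq+βm≡1 ⟩
        - (1ℤ * + M)                         ≡⟨ cong -_ (ℤ.*-identityˡ (+ M)) ⟩
        - + M                                ∎

    reduced-partner : ∃ λ w → w ∈𝓛 × ∣ det vector w ∣ ≡ M × 2 ℕ.* L ℕ.* ‖ w ‖ ≤ 2 ℕ.* M ℕ.+ L ℕ.* L
    reduced-partner = partner (reduce vector w 0<‖vector‖)
      where
      w = proj₁ completion
      w∈𝓛 = proj₁ (proj₂ completion)
      ∣det∣≡M : ∣ det vector w ∣ ≡ M
      ∣det∣≡M = trans (cong ∣_∣ (proj₂ (proj₂ completion))) (ℤ.∣-i∣≡∣i∣ (+ M))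
      partner : Reduction vector w →
        ∃ λ w₁ → w₁ ∈𝓛 × ∣ det vector w₁ ∣ ≡ M × 2 ℕ.* L ℕ.* ‖ w₁ ‖ ≤ 2 ℕ.* M ℕ.+ L ℕ.* L
      partner (t , bound) =
        w ⊟ t ⊙ vector , ∈𝓛-⊟⊙ vector w t vector∈𝓛 w∈𝓛 , trans (cong ∣_∣ (det-⊟⊙ vector w t)) ∣det∣≡M ,
        subst₂ (λ ℓ D → 2 ℕ.* ℓ ℕ.* ‖ w ⊟ t ⊙ vector ‖ ≤ 2 ℕ.* D ℕ.+ ℓ ℕ.* ℓ) ‖vector‖ ∣det∣≡M bound

    -- A partner shorter than L has even second coordinate (by minimality), so reducing vector
    -- against it keeps the second coordinate odd, and minimality applies to the result.
    short-partner : ∀ w → w ∈𝓛 → ∣ det vector w ∣ ≡ M → 0 < ‖ w ‖ → ‖ w ‖ < L →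
      ‖ w ‖ ℕ.* L ≤ 2 ℕ.* M
    short-partner w w∈𝓛 ∣det∣≡M 0<‖w‖ ‖w‖<L =
      product-bound {‖ w ‖} {L} {M} (ℕ.<⇒≤ ‖w‖<L) (bound (reduce w vector 0<‖w‖))
      where
      not-odd : ¬ Odd (proj₂ w)
      not-odd odd-w = ℕ.<⇒≱ ‖w‖<L (minimal w w∈𝓛 odd-w)
      bound : Reduction w vector → 2 ℕ.* ‖ w ‖ ℕ.* L ≤ 2 ℕ.* M ℕ.+ ‖ w ‖ ℕ.* ‖ w ‖
      bound (t , reduced) = ℕ.≤-trans (ℕ.*-monoʳ-≤ (2 ℕ.* ‖ w ‖) L≤‖u₁‖)
        (subst (λ D → 2 ℕ.* ‖ w ‖ ℕ.* ‖ u₁ ‖ ≤ 2 ℕ.* D ℕ.+ ‖ w ‖ ℕ.* ‖ w ‖)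
          (trans (∣det∣-comm vector w) ∣det∣≡M) reduced)
        where
        u₁ = vector ⊟ t ⊙ w
        L≤‖u₁‖ : L ≤ ‖ u₁ ‖
        L≤‖u₁‖ = minimal u₁ (∈𝓛-⊟⊙ w vector t w∈𝓛 vector∈𝓛) (odd-⊟ t odd not-odd)

    short-vector : 0 < M → ∃ λ v → v ∈𝓛 × 0 < ‖ v ‖ × ‖ v ‖ ℕ.* L ≤ 2 ℕ.* M
    short-vector 0<M with L ℕ.* L ℕ.≤? 2 ℕ.* M
    ... | yes L²≤2M =
      vector , vector∈𝓛 , 0<‖vector‖ , subst (λ ℓ → ℓ ℕ.* L ≤ 2 ℕ.* M) (sym ‖vector‖) L²≤2M
    ... | no L²≰2M = w , w∈𝓛 , 0<‖w‖ , short-partner w w∈𝓛 ∣det∣≡M 0<‖w‖ ‖w‖<L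
      where
      w = proj₁ reduced-partner
      w∈𝓛 = proj₁ (proj₂ reduced-partner)
      ∣det∣≡M = proj₁ (proj₂ (proj₂ reduced-partner))
      0<‖w‖ : 0 < ‖ w ‖
      0<‖w‖ = det≢0⇒‖‖>0 vector w λ det≡0 → ℕ.<⇒≢ 0<M (trans (cong ∣_∣ (sym det≡0)) ∣det∣≡M)
      ‖w‖<L : ‖ w ‖ < L
      ‖w‖<L = shorter-than {L} {‖ w ‖} {M} (proj₂ (proj₂ (proj₂ reduced-partner))) (ℕ.≰⇒> L²≰2M)

module NthLambda (s : BinSeq) (N : ℕ) where

  open import Data.Integer using (_*_; _-_; -_)
  import Data.Integer.Properties as ℤ
  open import Data.Integer.Divisibility.Signed using (_∣_; ∣ᵤ⇒∣; ∣⇒∣ᵤ; ∣m⇒∣-m)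
  open import Data.Integer.Tactic.RingSolver using (solve-∀)
  open import Data.Nat as ℕ using (suc; _^_; _%_; _≤_; _⊔_)
  import Data.Nat.Properties as ℕ
  open import Data.Nat.DivMod using (m%n<n)
  import Data.Nat.Divisibility as ℕ∣
  open Integers using (Odd)
  open Plane using (‖_‖)
  open CongruenceLattice (2 ^ N) (+ partialSum s N)

  %2≡1⇒odd : ∀ {n} → n % 2 ≡ 1 → Odd (+ n)
  %2≡1⇒odd {n} n%2≡1 2∣n = contradiction (trans (sym (ℕ∣.n∣m⇒m%n≡0 n 2 (∣⇒∣ᵤ 2∣n))) n%2≡1) λ ()

  odd⇒%2≡1 : ∀ {n} → Odd (+ n) → n % 2 ≡ 1
  odd⇒%2≡1 {n} odd with ℕ.n≤1⇒n≡0∨n≡1 (ℕ.s≤s⁻¹ (m%n<n n 2))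
  ... | inj₁ n%2≡0 = contradiction (∣ᵤ⇒∣ (ℕ∣.m%n≡0⇒n∣m n 2 n%2≡0)) odd
  ... | inj₂ n%2≡1 = n%2≡1

  odd-minimum : ∀ {L} → IsNthLambda s N L → OddMinimum L
  odd-minimum {L} ((f , q , (q%2≡1 , M∣qx-f) , ‖f,q‖≡L) , least) = record
    { vector   = f , + q
    ; vector∈𝓛 = ∣ᵤ⇒∣ M∣qx-f
    ; odd      = %2≡1⇒odd q%2≡1
    ; ‖vector‖ = ‖f,q‖≡L
    ; minimal  = minimal
    }
    where
    lemma : ∀ e x c → - (- e * x - c) ≡ e * x - - c
    lemma = solve-∀
    minimal : ∀ v → v ∈𝓛 → Odd (proj₂ v) → L ≤ ‖ v ‖
    minimal (c , + n)      v∈𝓛 odd = least c n (odd⇒%2≡1 odd , ∣⇒∣ᵤ v∈𝓛)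
    minimal (c , -[1+ n ]) v∈𝓛 odd = subst (λ z → L ≤ z ⊔ suc n) (ℤ.∣-i∣≡∣i∣ c)
      (least (- c) (suc n) (odd⇒%2≡1 (odd ∘ ∣m⇒∣-m) , ∣⇒∣ᵤ M∣sn*x+c))
      where
      M∣sn*x+c : + (2 ^ N) ∣ + suc n * + partialSum s N - - c
      M∣sn*x+c = subst (+ (2 ^ N) ∣_) (lemma (+ suc n) (+ partialSum s N) c) (∣m⇒∣-m v∈𝓛)

open import Data.Nat using (zero; suc; _+_; _*_; _∸_; _^_; _≤_; _<_; s≤s; z≤n; >-nonZero)
open import Data.Nat.Properties
open import Data.Nat.Tactic.RingSolver using (solve-∀)
open import Data.Integer.Divisibility.Signed using (∣ᵤ⇒∣)
open import Data.Vec using (Vec)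

^-distribʳ-* : ∀ m n o → (m * n) ^ o ≡ m ^ o * n ^ o
^-distribʳ-* m n zero    = refl
^-distribʳ-* m n (suc o) = trans (cong (m * n *_) (^-distribʳ-* m n o)) (interchange m n (m ^ o) (n ^ o))
  where
  interchange : ∀ a b c d → a * b * (c * d) ≡ a * c * (b * d)
  interchange = solve-∀

m^n≤m*m^[n∸1] : ∀ m n → 0 < m → m ^ n ≤ m * m ^ (n ∸ 1)
m^n≤m*m^[n∸1] m zero    0<m = subst (1 ≤_) (sym (*-identityʳ m)) 0<m
m^n≤m*m^[n∸1] m (suc n) 0<m = ≤-refl

^-bound : ∀ d {M L H a} → 0 < M → M ≤ H * a ^ d → a * L ≤ 2 * M → L ^ d ≤ 2 ^ d * H * M ^ (d ∸ 1)
^-bound d {M} {L} {H} {a} 0<M M≤Haᵈ aL≤2M = *-cancelˡ-≤ M {{>-nonZero 0<M}} (begin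
  M * L ^ d                         ≤⟨ *-monoˡ-≤ (L ^ d) M≤Haᵈ ⟩
  H * a ^ d * L ^ d                 ≡⟨ *-assoc H (a ^ d) (L ^ d) ⟩
  H * (a ^ d * L ^ d)               ≡⟨ cong (H *_) (^-distribʳ-* a L d) ⟨
  H * (a * L) ^ d                   ≤⟨ *-monoʳ-≤ H (^-monoˡ-≤ d aL≤2M) ⟩
  H * (2 * M) ^ d                   ≡⟨ cong (H *_) (^-distribʳ-* 2 M d) ⟩
  H * (2 ^ d * M ^ d)               ≤⟨ *-monoʳ-≤ H (*-monoʳ-≤ (2 ^ d) (m^n≤m*m^[n∸1] M d 0<M)) ⟩
  H * (2 ^ d * (M * M ^ (d ∸ 1)))   ≡⟨ rearrange H (2 ^ d) M (M ^ (d ∸ 1)) ⟩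
  M * (2 ^ d * H * M ^ (d ∸ 1))     ∎)
  where
  open ≤-Reasoning
  rearrange : ∀ h t m r → h * (t * (m * r)) ≡ m * (t * h * r)
  rearrange = solve-∀

tenth-power-bound : ∀ d L H N → L ^ d ≤ 2 ^ d * H * (2 ^ N) ^ (d ∸ 1) →
  L ^ (10 * d) ≤ 2 ^ (10 * (d ∸ 1) * N + 13 * d) * H ^ 10
tenth-power-bound d L H N Lᵈ≤ = begin
  L ^ (10 * d)                             ≡⟨ cong (L ^_) (*-comm 10 d) ⟩
  L ^ (d * 10)                             ≡⟨ ^-*-assoc L d 10 ⟨
  (L ^ d) ^ 10                             ≤⟨ ^-monoˡ-≤ 10 Lᵈ≤ ⟩
  (2 ^ d * H * (2 ^ N) ^ D) ^ 10           ≡⟨ trans (^-distribʳ-* (2 ^ d * H) ((2 ^ N) ^ D) 10)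
                                                   (cong (_* ((2 ^ N) ^ D) ^ 10) (^-distribʳ-* (2 ^ d) H 10)) ⟩
  (2 ^ d) ^ 10 * H ^ 10 * ((2 ^ N) ^ D) ^ 10 ≡⟨ cong₂ (λ u v → u * H ^ 10 * v) (^-*-assoc 2 d 10)
                                                   (trans (^-*-assoc (2 ^ N) D 10) (^-*-assoc 2 N (D * 10))) ⟩
  2 ^ (d * 10) * H ^ 10 * 2 ^ E            ≤⟨ *-monoˡ-≤ (2 ^ E) (*-monoˡ-≤ (H ^ 10) (^-monoʳ-≤ 2 (*-monoʳ-≤ d 10≤13))) ⟩
  2 ^ (d * 13) * H ^ 10 * 2 ^ E            ≡⟨ rearrange (2 ^ (d * 13)) (H ^ 10) (2 ^ E) ⟩
  2 ^ E * 2 ^ (d * 13) * H ^ 10            ≡⟨ cong (_* H ^ 10) (^-distribˡ-+-* 2 E (d * 13)) ⟨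
  2 ^ (E + d * 13) * H ^ 10                ≡⟨ cong (λ n → 2 ^ n * H ^ 10) (exponent N D d) ⟩
  2 ^ (10 * D * N + 13 * d) * H ^ 10       ∎
  where
  open ≤-Reasoning
  D = d ∸ 1
  E = N * (D * 10)
  10≤13 : 10 ≤ 13
  10≤13 = s≤s (s≤s (s≤s (s≤s (s≤s (s≤s (s≤s (s≤s (s≤s (s≤s z≤n)))))))))
  rearrange : ∀ a b c → a * b * c ≡ c * a * b
  rearrange = solve-∀
  exponent : ∀ N D d → N * (D * 10) + d * 13 ≡ 10 * D * N + 13 * d
  exponent = solve-∀

theorem1 : (s : BinSeq) → ¬ EventuallyPeriodic s →
    (d : ℕ) (h : Vec ℤ (suc d)) → HasDegree h → NoRationalRoots h →
    IsTwoAdicRoot h s →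
    (N : ℕ) → 1 ≤ N → (L : ℕ) → IsNthLambda s N L →
    (2 ^ N ≤ height h * L ^ d)
    × (L ^ (10 * d) ≤ 2 ^ (10 * (d ∸ 1) * N + 13 * d) * height h ^ 10)
theorem1 s _ d h deg noRoots root N _ L isL = lower , tenth-power-bound d L (height h) N upper
  where
  open Plane using (‖_‖)
  open CongruenceLattice (2 ^ N) (+ partialSum s N)
  open OddMinimumProperties (NthLambda.odd-minimum s N isL)
  long : ∀ v → v ∈𝓛 → 0 < ‖ v ‖ → 2 ^ N ≤ height h * ‖ v ‖ ^ d
  long = M≤height*‖v‖^d h deg noRoots (∣ᵤ⇒∣ (root N))
  lower : 2 ^ N ≤ height h * L ^ d
  lower = subst (λ ℓ → 2 ^ N ≤ height h * ℓ ^ d) ‖vector‖ (long vector vector∈𝓛 0<‖vector‖)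
  upper : L ^ d ≤ 2 ^ d * height h * (2 ^ N) ^ (d ∸ 1)
  upper with short-vector (m^n>0 2 N)
  ... | v , v∈𝓛 , 0<‖v‖ , ‖v‖L≤2M = ^-bound d (m^n>0 2 N) (long v v∈𝓛 0<‖v‖) ‖v‖L≤2M
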